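{- Let $(v_n)_{n\ge0}$ be the regular paperfolding sequence over $\mathbb{F}_2$: $v_0\in\mathbb{F}_2$ is arbitrary, and for $n\ge 1$ written as $n=m\cdot 2^k$ with $m$ odd, \[ v_n=\begin{cases}1 & \text{if } m\equiv 1\pmod 4,\\ 0 & \text{if } m\equiv 3\pmod 4.\end{cases} \] Then \[ C_2(v_n,N)>\frac{N}{6}-2\qquad\text{for all } N\ge 12 . \]
   Context: For a binary sequence $(s_n)$ over $\mathbb{F}_2=\{0,1\}$, the $N$th correlation measure of order $2$ is \[ C_2(s_n,N)=\max_{M,d_1,d_2}\left|\sum_{n=0}^{M}(-1)^{s_{n+d_1}+s_{n+d_2}}\right|, \] where the maximum is taken over all integers $M\ge 0$ and $0\le d_1<d_2$ with $d_2+M<N$. -}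

module Defs where

open import Data.Bool using (Bool; true; false; _xor_)
open import Data.Nat using (ℕ; zero; suc; _+_; _*_; _∸_; _⊔_; _%_; _/_)
open import Data.Integer using (ℤ; +_; -[1+_]; ∣_∣)
import Data.Integer as ℤ
open import Data.List using (List; []; _∷_; map; foldr; upTo; concatMap)

-- odd part of a positive integer: m where n = m * 2^k, m odd.
-- Uses fuel (the fuel n suffices since halving at most n times).
oddPartFuel : ℕ → ℕ → ℕ
oddPartFuel zero    n = n
oddPartFuel (suc f) n with n % 2
... | zero  = oddPartFuel f (n / 2)
... | suc _ = n

oddPart : ℕ → ℕ
oddPart n = oddPartFuel n n

-- regular paperfolding sequence over F₂ (true = 1, false = 0), v₀ = b arbitrary
paperfolding : Bool → ℕ → Bool
paperfolding b zero = b
paperfolding b (suc n) with oddPart (suc n) % 4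
... | 1 = true
... | _ = false

sgn : Bool → ℤ
sgn false = + 1
sgn true  = -[1+ 0 ]

corrSum : (ℕ → Bool) → ℕ → ℕ → ℕ → ℤ
corrSum s M d1 d2 = foldr ℤ._+_ (+ 0)
  (map (λ n → sgn (s (n + d1) xor s (n + d2))) (upTo (suc M)))

maxList : List ℕ → ℕ
maxList = foldr _⊔_ 0

-- C₂(s, N) = max over M ≥ 0, 0 ≤ d1 < d2, d2 + M < N of |corrSum|
-- (empty max = 0, only possible when N ≤ 1)
C2 : (ℕ → Bool) → ℕ → ℕ
C2 s N = maxList
  (concatMap (λ d2 →
     concatMap (λ d1 →
       map (λ M → ∣ corrSum s M d1 d2 ∣) (upTo (N ∸ d2)))
     (upTo d2))
   (upTo N))

{-# OPTIONS --safe #-}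
module Submission where

-- The odd-indexed terms of v alternate, v₁ = 1, v₃ = 0, v₅ = 1, …, while v₂ₘ = vₘ.
-- Hence in the correlation sum with lags (1,3) over n ≤ 2K+1 every even n
-- contributes −1, and every odd n = 2i+1 contributes the term of lags (1,2) at i:
--   corrSum v (2K+1) 1 3 = −(K+1) + corrSum v K 1 2.
-- One of these two sums therefore has absolute value at least (K+1)/2, and both
-- are admissible in C₂(v,N) as soon as 2K+5 ≤ N; taking K maximal gives the bound.
-- Both lags are positive, so the arbitrary value v₀ never enters.

open import Defs
open import Data.Bool using (Bool; true; false; _xor_)
open import Data.Nat using (ℕ; zero; suc; _+_; _*_; _∸_; _%_; _/_; _≤_; _<_; z≤n; s≤s)
import Data.Nat.Properties as ℕ
open import Data.Nat.DivMod using (m*n%n≡0; m*n/n≡m; [m+n]%n≡m%n; [m+kn]%n≡m%n; m/n<m)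
open import Data.Integer using (ℤ; +_; -[1+_]; ∣_∣; -_)
import Data.Integer as ℤ
import Data.Integer.Properties as ℤ
import Data.Integer.Tactic.RingSolver as ℤ-Solver
import Data.Nat.Tactic.RingSolver as ℕ-Solver
open import Data.List using (_∷_; map; foldr; applyUpTo)
open import Data.List.Membership.Propositional using (_∈_; lose)
open import Data.List.Membership.Propositional.Properties using (∈-map⁺; ∈-concatMap⁺; ∈-upTo⁺)
open import Data.List.Relation.Unary.Any using (here; there)
open import Data.Product using (Σ-syntax; _×_; _,_)
open import Relation.Binary.PropositionalEquality

oddPartFuel-zero : ∀ f → oddPartFuel f 0 ≡ 0
oddPartFuel-zero zero    = refl
oddPartFuel-zero (suc f) = oddPartFuel-zero f

n≤1+f⇒n/2≤f : ∀ n f → n ≤ suc f → n / 2 ≤ f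
n≤1+f⇒n/2≤f zero    f _   = z≤n
n≤1+f⇒n/2≤f (suc n) f n≤f = ℕ.<⇒≤pred (ℕ.<-≤-trans (m/n<m (suc n) 2 (s≤s (s≤s z≤n))) n≤f)

oddPartFuel-irrelevant : ∀ f g n → n ≤ f → n ≤ g → oddPartFuel f n ≡ oddPartFuel g n
oddPartFuel-irrelevant zero    g       .zero z≤n _   = sym (oddPartFuel-zero g)
oddPartFuel-irrelevant (suc f) zero    .zero _   z≤n = oddPartFuel-zero (suc f)
oddPartFuel-irrelevant (suc f) (suc g) n     n≤f n≤g with n % 2
... | zero  = oddPartFuel-irrelevant f g (n / 2) (n≤1+f⇒n/2≤f n f n≤f) (n≤1+f⇒n/2≤f n g n≤g)
... | suc _ = refl

oddPartFuel-odd : ∀ f n → n % 2 ≡ 1 → oddPartFuel (suc f) n ≡ n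
oddPartFuel-odd f n n%2≡1 with n % 2
oddPartFuel-odd f n () | zero
... | suc _ = refl

oddPartFuel-even : ∀ f n → n % 2 ≡ 0 → oddPartFuel (suc f) n ≡ oddPartFuel f (n / 2)
oddPartFuel-even f n n%2≡0 with n % 2
... | zero = refl
oddPartFuel-even f n () | suc _

oddPart-odd : ∀ n → suc n % 2 ≡ 1 → oddPart (suc n) ≡ suc n
oddPart-odd n = oddPartFuel-odd n (suc n)

oddPart-double : ∀ m → oddPart (suc m * 2) ≡ oddPart (suc m)
oddPart-double m = begin
  oddPartFuel (suc (suc (m * 2))) (suc m * 2)
    ≡⟨ oddPartFuel-even (suc (m * 2)) (suc m * 2) (m*n%n≡0 (suc m) 2) ⟩
  oddPartFuel (suc (m * 2)) (suc m * 2 / 2)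
    ≡⟨ cong (oddPartFuel (suc (m * 2))) (m*n/n≡m (suc m) 2) ⟩
  oddPartFuel (suc (m * 2)) (suc m)
    ≡⟨ oddPartFuel-irrelevant (suc (m * 2)) (suc m) (suc m) (s≤s (ℕ.m≤m*n m 2)) ℕ.≤-refl ⟩
  oddPartFuel (suc m) (suc m) ∎
  where open ≡-Reasoning

∑ : ℕ → (ℕ → ℤ) → ℤ
∑ zero    f = + 0
∑ (suc n) f = f 0 ℤ.+ ∑ n (λ i → f (suc i))

∑-cong : ∀ n {f g} → (∀ i → f i ≡ g i) → ∑ n f ≡ ∑ n g
∑-cong zero    f≗g = refl
∑-cong (suc n) f≗g = cong₂ ℤ._+_ (f≗g 0) (∑-cong n (λ i → f≗g (suc i)))

∑-minus-one : ∀ n → ∑ n (λ _ → -[1+ 0 ]) ≡ - + n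
∑-minus-one zero          = refl
∑-minus-one (suc zero)    = refl
∑-minus-one (suc (suc n)) = cong (λ t → -[1+ 0 ] ℤ.+ t) (∑-minus-one (suc n))

∑-even-odd : ∀ k f → ∑ (k * 2) f ≡ ∑ k (λ i → f (i * 2)) ℤ.+ ∑ k (λ i → f (suc (i * 2)))
∑-even-odd zero    f = refl
∑-even-odd (suc k) f = begin
  f 0 ℤ.+ (f 1 ℤ.+ ∑ (k * 2) (λ i → f (suc (suc i))))
    ≡⟨ cong (λ t → f 0 ℤ.+ (f 1 ℤ.+ t)) (∑-even-odd k (λ i → f (suc (suc i)))) ⟩
  f 0 ℤ.+ (f 1 ℤ.+ (E ℤ.+ O))
    ≡⟨ interchange (f 0) (f 1) E O ⟩
  (f 0 ℤ.+ E) ℤ.+ (f 1 ℤ.+ O) ∎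
  where
  open ≡-Reasoning
  E = ∑ k (λ i → f (suc i * 2))
  O = ∑ k (λ i → f (suc (suc i * 2)))
  interchange : ∀ a b x y → a ℤ.+ (b ℤ.+ (x ℤ.+ y)) ≡ (a ℤ.+ x) ℤ.+ (b ℤ.+ y)
  interchange = ℤ-Solver.solve-∀

foldr-+-map-applyUpTo : ∀ {A : Set} (h : A → ℤ) (g : ℕ → A) n →
                        foldr ℤ._+_ (+ 0) (map h (applyUpTo g n)) ≡ ∑ n (λ i → h (g i))
foldr-+-map-applyUpTo h g zero    = refl
foldr-+-map-applyUpTo h g (suc n) =
  cong (λ t → h (g 0) ℤ.+ t) (foldr-+-map-applyUpTo h (λ i → g (suc i)) n)

corrTerm : (ℕ → Bool) → ℕ → ℕ → ℕ → ℤ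
corrTerm s d₁ d₂ n = sgn (s (n + d₁) xor s (n + d₂))

corrSum≡∑ : ∀ s M d₁ d₂ → corrSum s M d₁ d₂ ≡ ∑ (suc M) (corrTerm s d₁ d₂)
corrSum≡∑ s M d₁ d₂ = foldr-+-map-applyUpTo (corrTerm s d₁ d₂) (λ i → i) (suc M)

≤-maxList : ∀ {x} xs → x ∈ xs → x ≤ maxList xs
≤-maxList (y ∷ ys) (here refl) = ℕ.m≤m⊔n y (maxList ys)
≤-maxList (y ∷ ys) (there x∈ys) = ℕ.≤-trans (≤-maxList ys x∈ys) (ℕ.m≤n⊔m y (maxList ys))

∣corrSum∣≤C2 : ∀ s N {M d₁ d₂} → d₁ < d₂ → d₂ + M < N → ∣ corrSum s M d₁ d₂ ∣ ≤ C2 s N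
∣corrSum∣≤C2 s N {M} {d₁} {d₂} d₁<d₂ d₂+M<N =
  ≤-maxList _ (∈-concatMap⁺ _ (lose (∈-upTo⁺ d₂<N)
               (∈-concatMap⁺ _ (lose (∈-upTo⁺ d₁<d₂)
                 (∈-map⁺ (λ M → ∣ corrSum s M d₁ d₂ ∣) (∈-upTo⁺ M<N∸d₂))))))
  where
  d₂<N : d₂ < N
  d₂<N = ℕ.≤-<-trans (ℕ.m≤m+n d₂ M) d₂+M<N
  M<N∸d₂ : M < N ∸ d₂
  M<N∸d₂ = ℕ.+-cancelˡ-< d₂ M (N ∸ d₂) (subst (d₂ + M <_) (sym (ℕ.m+[n∸m]≡n (ℕ.<⇒≤ d₂<N))) d₂+M<N)

module LagIdentity
  (s : ℕ → Bool)
  (odd-alternates : ∀ i → s (suc (i * 2)) xor s (suc (suc i * 2)) ≡ true)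
  (double : ∀ m → s (suc m * 2) ≡ s (suc m))
  where

  corrTerm-even : ∀ i → corrTerm s 1 3 (i * 2) ≡ -[1+ 0 ]
  corrTerm-even i = cong sgn (begin
    s (i * 2 + 1) xor s (i * 2 + 3)
      ≡⟨ cong₂ (λ x y → s x xor s y) (ℕ.+-comm (i * 2) 1) (ℕ.+-comm (i * 2) 3) ⟩
    s (suc (i * 2)) xor s (suc (suc i * 2))
      ≡⟨ odd-alternates i ⟩
    true ∎)
    where open ≡-Reasoning

  corrTerm-odd : ∀ i → corrTerm s 1 3 (suc (i * 2)) ≡ corrTerm s 1 2 i
  corrTerm-odd i = cong₂ (λ x y → sgn (x xor y)) (lag 0) (lag 1)
    where
    open ≡-Reasoning
    shift : ∀ i k → suc (i * 2) + (1 + k * 2) ≡ suc (k + i) * 2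
    shift = ℕ-Solver.solve-∀
    lag : ∀ k → s (suc (i * 2) + (1 + k * 2)) ≡ s (i + suc k)
    lag k = begin
      s (suc (i * 2) + (1 + k * 2)) ≡⟨ cong s (shift i k) ⟩
      s (suc (k + i) * 2)           ≡⟨ double (k + i) ⟩
      s (suc k + i)                 ≡⟨ cong s (ℕ.+-comm (suc k) i) ⟩
      s (i + suc k) ∎

  corrSum-1-3 : ∀ K → corrSum s (suc (K * 2)) 1 3 ≡ - + suc K ℤ.+ corrSum s K 1 2
  corrSum-1-3 K = begin
    corrSum s (suc (K * 2)) 1 3
      ≡⟨ corrSum≡∑ s (suc (K * 2)) 1 3 ⟩
    ∑ (suc K * 2) (corrTerm s 1 3)
      ≡⟨ ∑-even-odd (suc K) (corrTerm s 1 3) ⟩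
    ∑ (suc K) (λ i → corrTerm s 1 3 (i * 2)) ℤ.+ ∑ (suc K) (λ i → corrTerm s 1 3 (suc (i * 2)))
      ≡⟨ cong₂ ℤ._+_ (trans (∑-cong (suc K) corrTerm-even) (∑-minus-one (suc K)))
                     (∑-cong (suc K) corrTerm-odd) ⟩
    - + suc K ℤ.+ ∑ (suc K) (corrTerm s 1 2)
      ≡⟨ cong (λ t → - + suc K ℤ.+ t) (sym (corrSum≡∑ s K 1 2)) ⟩
    - + suc K ℤ.+ corrSum s K 1 2 ∎
    where open ≡-Reasoning

  1+K≤C2+C2 : ∀ K N → 5 + K * 2 ≤ N → suc K ≤ C2 s N + C2 s N
  1+K≤C2+C2 K N 5+2K≤N = begin
    suc K                  ≡⟨ cong ∣_∣ (k≡t-[-k+t] (+ suc K) short) ⟩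
    ∣ short ℤ.- (- + suc K ℤ.+ short) ∣ ≡⟨ cong (λ t → ∣ short ℤ.- t ∣) (sym (corrSum-1-3 K)) ⟩
    ∣ short ℤ.- long ∣     ≤⟨ ℤ.∣i-j∣≤∣i∣+∣j∣ short long ⟩
    ∣ short ∣ + ∣ long ∣   ≤⟨ ℕ.+-mono-≤ short≤C2 long≤C2 ⟩
    C2 s N + C2 s N ∎
    where
    open ℕ.≤-Reasoning
    short = corrSum s K 1 2
    long  = corrSum s (suc (K * 2)) 1 3
    k≡t-[-k+t] : ∀ k t → k ≡ t ℤ.- (- k ℤ.+ t)
    k≡t-[-k+t] = ℤ-Solver.solve-∀
    short≤C2 : ∣ short ∣ ≤ C2 s N
    short≤C2 = ∣corrSum∣≤C2 s N (s≤s (s≤s z≤n))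
      (ℕ.≤-trans (ℕ.+-mono-≤ (s≤s (s≤s (s≤s z≤n))) (ℕ.m≤m*n K 2)) 5+2K≤N)
    long≤C2 : ∣ long ∣ ≤ C2 s N
    long≤C2 = ∣corrSum∣≤C2 s N (s≤s (s≤s z≤n)) 5+2K≤N

isOne : ℕ → Bool
isOne 1 = true
isOne _ = false

module Paperfolding (b : Bool) where

  v : ℕ → Bool
  v = paperfolding b

  v-suc : ∀ n → v (suc n) ≡ isOne (oddPart (suc n) % 4)
  v-suc n with oddPart (suc n) % 4
  ... | zero        = refl
  ... | suc zero    = refl
  ... | suc (suc _) = refl

  v-double : ∀ m → v (suc m * 2) ≡ v (suc m)
  v-double m = begin
    v (suc m * 2)                        ≡⟨ v-suc (suc (m * 2)) ⟩
    isOne (oddPart (suc m * 2) % 4)      ≡⟨ cong (λ k → isOne (k % 4)) (oddPart-double m) ⟩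
    isOne (oddPart (suc m) % 4)          ≡⟨ sym (v-suc m) ⟩
    v (suc m) ∎
    where open ≡-Reasoning

  v-odd : ∀ n → v (suc (n * 2)) ≡ isOne (suc (n * 2) % 4)
  v-odd n = begin
    v (suc (n * 2))                      ≡⟨ v-suc (n * 2) ⟩
    isOne (oddPart (suc (n * 2)) % 4)    ≡⟨ cong (λ k → isOne (k % 4)) (oddPart-odd (n * 2) ([m+kn]%n≡m%n 1 n 2)) ⟩
    isOne (suc (n * 2) % 4) ∎
    where open ≡-Reasoning

  v-odd-period : ∀ n → v (4 + suc (n * 2)) ≡ v (suc (n * 2))
  v-odd-period n = begin
    v (4 + suc (n * 2))                  ≡⟨ v-odd (2 + n) ⟩
    isOne ((4 + suc (n * 2)) % 4)        ≡⟨ cong (λ k → isOne (k % 4)) (ℕ.+-comm 4 (suc (n * 2))) ⟩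
    isOne ((suc (n * 2) + 4) % 4)        ≡⟨ cong isOne ([m+n]%n≡m%n (suc (n * 2)) 4) ⟩
    isOne (suc (n * 2) % 4)              ≡⟨ sym (v-odd n) ⟩
    v (suc (n * 2)) ∎
    where open ≡-Reasoning

  v-odd-alternates : ∀ i → v (suc (i * 2)) xor v (suc (suc i * 2)) ≡ true
  v-odd-alternates zero          = refl
  v-odd-alternates (suc zero)    = refl
  v-odd-alternates (suc (suc i)) =
    subst₂ (λ x y → x xor y ≡ true) (sym (v-odd-period i)) (sym (v-odd-period (suc i)))
      (v-odd-alternates i)

  open LagIdentity v v-odd-alternates v-double public

halving : ∀ t → Σ[ K ∈ ℕ ] (K * 2 ≤ t × t ≤ suc (K * 2))
halving zero          = 0 , z≤n , z≤n
halving (suc zero)    = 0 , z≤n , s≤s z≤n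
halving (suc (suc t)) with halving t
... | K , 2K≤t , t≤1+2K = suc K , s≤s (s≤s 2K≤t) , s≤s (s≤s t≤1+2K)

N<6*C+12 : ∀ {N K C} → N ≤ 6 + K * 2 → suc K ≤ C + C → N < 6 * C + 12
N<6*C+12 {N} {K} {C} N≤6+2K K<2C = begin-strict
  N               ≤⟨ N≤6+2K ⟩
  6 + K * 2       <⟨ ℕ.+-mono-<-≤ (ℕ.m≤m+n 7 8) (ℕ.*-monoʳ-≤ K (ℕ.n≤1+n 2)) ⟩
  15 + K * 3      ≡⟨ regroup K ⟩
  3 * suc K + 12  ≤⟨ ℕ.+-monoˡ-≤ 12 (ℕ.*-monoʳ-≤ 3 K<2C) ⟩
  3 * (C + C) + 12 ≡⟨ cong (_+ 12) (double C) ⟩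
  6 * C + 12 ∎
  where
  open ℕ.≤-Reasoning
  regroup : ∀ K → 15 + K * 3 ≡ 3 * suc K + 12
  regroup = ℕ-Solver.solve-∀
  double : ∀ C → 3 * (C + C) ≡ 6 * C
  double = ℕ-Solver.solve-∀

corollary2 : (b : Bool) (N : ℕ) → 12 ≤ N →
    N < 6 * C2 (paperfolding b) N + 12
corollary2 b N 12≤N with halving (N ∸ 5)
... | K , 2K≤N∸5 , N∸5≤1+2K =
  N<6*C+12 {C = C2 (paperfolding b) N} N≤6+2K (Paperfolding.1+K≤C2+C2 b K N 5+2K≤N)
  where
  N≡5+t : N ≡ 5 + (N ∸ 5)
  N≡5+t = sym (ℕ.m+[n∸m]≡n (ℕ.≤-trans (ℕ.m≤m+n 5 7) 12≤N))
  5+2K≤N : 5 + K * 2 ≤ N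
  5+2K≤N = subst (5 + K * 2 ≤_) (sym N≡5+t) (ℕ.+-monoʳ-≤ 5 2K≤N∸5)
  N≤6+2K : N ≤ 6 + K * 2
  N≤6+2K = subst (_≤ 6 + K * 2) (sym N≡5+t) (ℕ.+-monoʳ-≤ 5 N∸5≤1+2K)
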